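{- Let $\mathit{Atm}_0$ be finite. Then the logic $\mathsf{PLC}$ is sound and complete relative to the class $\mathbf{MCM}$: a formula of $\mathcal{L}$ is a theorem of $\mathsf{PLC}$ if and only if it is valid in every multi-classifier model.
   Context: Let $\mathit{Atm}_0$ be a set of atomic propositions and $\mathit{Val}$ a finite set of output values; decision atoms $\mathsf{t}(x)$ for $x\in\mathit{Val}$. Language $\mathcal{L}$: $\varphi ::= p \mid \mathsf{t}(x)\mid \neg\varphi\mid \varphi\wedge\varphi\mid \Box_{\mathtt{I}}\varphi\mid \Box_{\mathtt{F}}\varphi$ ($p\in\mathit{Atm}_0$, $x\in\mathit{Val}$). A multi-classifier model (MCM) is a pair $\Gamma=(S,\Phi)$ with $S\subseteq 2^{\mathit{Atm}_0}$ and $\Phi$ a set of functions from $S$ to $\mathit{Val}$. For $s\in S$, $f\in\Phi$: $(\Gamma,s,f)\models p$ iff $p\in s$; $(\Gamma,s,f)\models\mathsf{t}(x)$ iff $f(s)=x$; Boolean connectives as usual; $(\Gamma,s,f)\models\Box_{\mathtt{I}}\varphi$ iff $(\Gamma,s',f)\models\varphi$ for all $s'\in S$; $(\Gamma,s,f)\models\Box_{\mathtt{F}}\varphi$ iff $(\Gamma,s,f')\models\varphi$ for all $f'\in\Phi$. $\varphi$ is valid relative to $\mathbf{MCM}$ if it holds at every $(\Gamma,s,f)$. For finite $X,Y\subseteq\mathit{Atm}_0$ let $\mathrm{cn}_{X,Y}=\bigwedge_{p\in X}p\wedge\bigwedge_{p\in Y\setminus X}\neg p$. The logic $\mathsf{PLC}$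 is the extension of classical propositional logic by the following axioms and rules, $\blacksquare$ ranging over $\{\Box_{\mathtt{I}},\Box_{\mathtt{F}}\}$: K: $(\blacksquare\varphi\wedge\blacksquare(\varphi\to\psi))\to\blacksquare\psi$; T: $\blacksquare\varphi\to\varphi$; 4: $\blacksquare\varphi\to\blacksquare\blacksquare\varphi$; 5: $\neg\blacksquare\varphi\to\blacksquare\neg\blacksquare\varphi$; Comm: $\Box_{\mathtt{F}}\Box_{\mathtt{I}}\varphi\leftrightarrow\Box_{\mathtt{I}}\Box_{\mathtt{F}}\varphi$; AtLeast: $\bigvee_{x\in\mathit{Val}}\mathsf{t}(x)$; AtMost: $\mathsf{t}(x)\to\neg\mathsf{t}(y)$ for $x\neq y$; Funct: $(\mathrm{cn}_{X,\mathit{Atm}_0}\wedge\mathsf{t}(x))\to\Box_{\mathtt{I}}(\mathrm{cn}_{X,\mathit{Atm}_0}\to\mathsf{t}(x))$ for $X\subseteq\mathit{Atm}_0$; Indep: $p\to\Box_{\mathtt{F}}p$ and $\neg p\to\Box_{\mathtt{F}}\neg p$ for $p\in\mathit{Atm}_0$; Nec: from $\varphi$ infer $\blacksquare\varphi$. -}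

module Defs where

open import Data.Nat using (ℕ)
open import Data.Fin using (Fin)
open import Data.Fin.Subset using (Subset)
open import Data.Vec using (lookup)
open import Data.List using (List; foldr; map)
open import Data.Fin.Base using ()
open import Data.List.Base using ()
open import Data.Bool using (Bool; true; false; not; _∧_; T; if_then_else_)
open import Data.Product using (Σ; _×_)
open import Data.Empty using (⊥)
open import Relation.Binary.PropositionalEquality using (_≡_; _≢_)
import Data.List as L

-- Atm₀ = Fin n (a finite set of atoms), Val = Fin m (a finite set of values).

data Box : Set where
  I F : Box

data Form (n m : ℕ) : Set where
  atom : Fin n → Form n m
  t    : Fin m → Form n m
  ~_   : Form n m → Form n m
  _&_  : Form n m → Form n m → Form n m
  □    : Box → Form n m → Form n m

infix 8 ~_
infixr 6 _&_

module _ {n m : ℕ} where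

  infixr 5 _∨′_
  infixr 4 _⇒_
  infix 3 _⇔′_

  _⇒_ : Form n m → Form n m → Form n m
  φ ⇒ ψ = ~ (φ & ~ ψ)

  _∨′_ : Form n m → Form n m → Form n m
  φ ∨′ ψ = ~ (~ φ & ~ ψ)

  _⇔′_ : Form n m → Form n m → Form n m
  φ ⇔′ ψ = (φ ⇒ ψ) & (ψ ⇒ φ)

  -- The language has no propositional constants, so ⊥ and ⊤ are
  -- represented as ψ ∧ ¬ψ and ¬(ψ ∧ ¬ψ) for an (arbitrary) formula ψ.
  falsum : Form n m → Form n m
  falsum ψ = ψ & ~ ψ

  verum : Form n m → Form n m
  verum ψ = ~ (ψ & ~ ψ)

  bigOr : Form n m → List (Form n m) → Form n m
  bigOr ψ = foldr _∨′_ (falsum ψ)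

  bigAnd : Form n m → List (Form n m) → Form n m
  bigAnd ψ = foldr _&_ (verum ψ)

  lit : Subset n → Fin n → Form n m
  lit X i = if lookup X i then atom i else ~ atom i

  cn : Form n m → Subset n → Form n m
  cn ψ X = bigAnd ψ (map (lit X) (L.allFin n))

  atLeastF : Form n m → Form n m
  atLeastF ψ = bigOr ψ (map t (L.allFin m))

  -- Classical propositional logic: tautologies, where atoms, decision
  -- atoms and boxed formulas are treated as propositional variables.
  evalB : (Form n m → Bool) → Form n m → Bool
  evalB v (atom p) = v (atom p)
  evalB v (t x)    = v (t x)
  evalB v (~ φ)    = not (evalB v φ)
  evalB v (φ & ψ)  = evalB v φ ∧ evalB v ψ
  evalB v (□ b φ)  = v (□ b φ)

  Taut : Form n m → Set
  Taut φ = (v : Form n m → Bool) → evalB v φ ≡ true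

data PLC {n m : ℕ} : Form n m → Set where
  taut   : ∀ {φ} → Taut φ → PLC φ
  mp     : ∀ {φ ψ} → PLC φ → PLC (φ ⇒ ψ) → PLC ψ
  axK    : ∀ b φ ψ → PLC ((□ b φ & □ b (φ ⇒ ψ)) ⇒ □ b ψ)
  axT    : ∀ b φ → PLC (□ b φ ⇒ φ)
  ax4    : ∀ b φ → PLC (□ b φ ⇒ □ b (□ b φ))
  ax5    : ∀ b φ → PLC (~ □ b φ ⇒ □ b (~ □ b φ))
  comm   : ∀ φ → PLC (□ F (□ I φ) ⇔′ □ I (□ F φ))
  atLeast : ∀ ψ → PLC (atLeastF ψ)
  atMost : ∀ (x y : Fin m) → x ≢ y → PLC (t x ⇒ ~ t y)
  funct  : ∀ ψ (X : Subset n) (x : Fin m) →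
           PLC ((cn ψ X & t x) ⇒ □ I (cn ψ X ⇒ t x))
  indep+ : ∀ (p : Fin n) → PLC (atom p ⇒ □ F (atom p))
  indep- : ∀ (p : Fin n) → PLC (~ atom p ⇒ □ F (~ atom p))
  nec    : ∀ b {φ} → PLC φ → PLC (□ b φ)

-- Multi-classifier models: S ⊆ 2^{Atm₀} (as a decidable subset of
-- Subset n) and Φ a set of functions S → Val.
record MCM (n m : ℕ) : Set₁ where
  field
    S : Subset n → Bool
  State : Set
  State = Σ (Subset n) (λ s → T (S s))
  field
    Φ : (State → Fin m) → Set

open MCM public

module _ {n m : ℕ} where

  infix 2 _,_,_⊨_
  _,_,_⊨_ : (Γ : MCM n m) → State Γ → (State Γ → Fin m) → Form n m → Set
  Γ , s , f ⊨ atom p = T (lookup (Σ.proj₁ s) p)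
  Γ , s , f ⊨ t x    = f s ≡ x
  Γ , s , f ⊨ ~ φ    = (Γ , s , f ⊨ φ) → ⊥
  Γ , s , f ⊨ (φ & ψ) = (Γ , s , f ⊨ φ) × (Γ , s , f ⊨ ψ)
  Γ , s , f ⊨ □ I φ  = (s′ : State Γ) → Γ , s′ , f ⊨ φ
  Γ , s , f ⊨ □ F φ  = (f′ : State Γ → Fin m) → Φ Γ f′ → Γ , s , f′ ⊨ φ

  Valid : Form n m → Set₁
  Valid φ = (Γ : MCM n m) (s : State Γ) (f : State Γ → Fin m) → Φ Γ f →
            Γ , s , f ⊨ φ

-- For completeness let φ be valid. A diagram
-- decides, for each of the finitely many assignments X to the atoms, whether X is realised
-- (◇I cn_X), and for each table g of a function from assignments to values, whether some
-- classifier computes g (◇F □I ⋀_X (cn_X → t(g X))). Excluded middle, AtLeast and Funct prove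
-- the disjunction, over all diagrams D, assignments X and tables g, of D ∧ cn_X ∧ "the current
-- classifier computes g". By Indep, Comm and S5 a diagram is stable under □I and □F, and it
-- describes a finite MCM whose states are the realised assignments and whose classifiers compute
-- the admissible tables. A truth lemma shows that each disjunct proves every formula that holds
-- at the corresponding point of that model, so it proves φ when the point exists; the other
-- disjuncts are refuted with T.
module Submission where

open import Defs
open import Data.Nat using (ℕ; zero; suc; _+_)
open import Data.Bool using (Bool; true; false; not; _∧_; T; if_then_else_)
import Data.Bool as Bool
open import Data.Bool.Properties using (T-≡; T-∧; T-irrelevant; ∧-zeroʳ; T?)
open import Data.Fin using (Fin; _≟_) renaming (zero to fzero; suc to fsuc)
open import Data.Vec using (Vec; []; _∷_; lookup)
import Data.Vec as Vec
open import Data.Vec.Properties using (lookup-map; lookup∘tabulate; tabulate∘lookup; tabulate-cong) renaming (≡-dec to ≡-decⱽ)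
open import Data.Product using (Σ; ∃; _×_; _,_; proj₁; proj₂)
open import Data.Product.Properties using (≡-dec)
open import Data.List using (List; []; _∷_; map; _++_; cartesianProduct; allFin)
open import Data.Bool.ListAction using (all)
open import Data.List.Base using (filterᵇ)
open import Data.List.Membership.Propositional using (_∈_; find)
open import Data.List.Membership.Propositional.Properties using (∈-map⁺; ∈-++⁺ˡ; ∈-++⁺ʳ; ∈-cartesianProduct⁺; ∈-allFin; ∈-filter⁺; ∈-filter⁻)
open import Data.List.Relation.Unary.Any using (here; there)
import Data.List.Relation.Unary.All as All
open import Data.List.Relation.Unary.All.Properties using (all⁺; all⁻; ¬All⇒Any¬)
open import Function using (_∘_; _⇔_; mk⇔; Equivalence)
open import Relation.Binary.PropositionalEquality using (_≡_; refl; sym; trans; cong; cong₂; module ≡-Reasoning)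
open import Relation.Binary.Definitions using (DecidableEquality)
open import Relation.Nullary using (¬_; Dec; yes; no)
open import Relation.Nullary.Decidable using (⌊_⌋; toWitness; fromWitness)
open import Data.Empty using (⊥-elim)
open import Data.Unit using (⊤)

open Equivalence using (to; from)

allSubsets : (k : ℕ) → List (Vec Bool k)
allSubsets zero = [] ∷ []
allSubsets (suc k) = map (true ∷_) (allSubsets k) ++ map (false ∷_) (allSubsets k)

∈-allSubsets : ∀ {k} (X : Vec Bool k) → X ∈ allSubsets k
∈-allSubsets [] = here refl
∈-allSubsets (true ∷ X) = ∈-++⁺ˡ (∈-map⁺ (true ∷_) (∈-allSubsets X))
∈-allSubsets {suc k} (false ∷ X) =
  ∈-++⁺ʳ (map (true ∷_) (allSubsets k)) (∈-map⁺ (false ∷_) (∈-allSubsets X))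

T-not : ∀ {b} → (¬ T b) ⇔ T (not b)
T-not {true} = mk⇔ (λ ¬b → ¬b _) λ ()
T-not {false} = mk⇔ _ λ _ ()

module _ {A : Set} (p : A → Bool) (xs : List A) where

  all-∈ : T (all p xs) → ∀ {x} → x ∈ xs → T (p x)
  all-∈ holds = All.lookup (all⁺ p xs holds)

  ¬all-∈ : ¬ T (all p xs) → ∃ λ x → x ∈ xs × ¬ T (p x)
  ¬all-∈ fails = find (¬All⇒Any¬ (T? ∘ p) xs (fails ∘ all⁻ p))

data Schema (k : ℕ) : Set where
  var  : Fin k → Schema k
  ¬ˢ_  : Schema k → Schema k
  _∧ˢ_ : Schema k → Schema k → Schema k

infix 8 ¬ˢ_
infixr 6 _∧ˢ_
infixr 5 _∨ˢ_
infixr 4 _⇒ˢ_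

_⇒ˢ_ _∨ˢ_ : ∀ {k} → Schema k → Schema k → Schema k
σ ⇒ˢ τ = ¬ˢ (σ ∧ˢ ¬ˢ τ)
σ ∨ˢ τ = ¬ˢ (¬ˢ σ ∧ˢ ¬ˢ τ)

evalˢ : ∀ {k} → Schema k → Vec Bool k → Bool
evalˢ (var i) bs = lookup bs i
evalˢ (¬ˢ σ) bs = not (evalˢ σ bs)
evalˢ (σ ∧ˢ τ) bs = evalˢ σ bs ∧ evalˢ τ bs

Tautological : ∀ {k} → Schema k → Set
Tautological {k} σ = T (all (evalˢ σ) (allSubsets k))

module _ {n m : ℕ} where

  instantiate : ∀ {k} → Schema k → Vec (Form n m) k → Form n m
  instantiate (var i) ρ = lookup ρ i
  instantiate (¬ˢ σ) ρ = ~ instantiate σ ρ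
  instantiate (σ ∧ˢ τ) ρ = instantiate σ ρ & instantiate τ ρ

  evalB-instantiate : ∀ {k} v (σ : Schema k) ρ →
                      evalB v (instantiate σ ρ) ≡ evalˢ σ (Vec.map (evalB v) ρ)
  evalB-instantiate v (var i) ρ = sym (lookup-map i (evalB v) ρ)
  evalB-instantiate v (¬ˢ σ) ρ = cong not (evalB-instantiate v σ ρ)
  evalB-instantiate v (σ ∧ˢ τ) ρ =
    cong₂ _∧_ (evalB-instantiate v σ ρ) (evalB-instantiate v τ ρ)

  -- Tautological σ evaluates σ under all 2ᵏ assignments, so for a concrete schema it
  -- normalises to ⊤ and the implicit argument is filled in automatically.
  tautology : ∀ {k} (σ : Schema k) {σ-taut : Tautological σ} ρ → PLC (instantiate σ ρ)
  tautology {k} σ {σ-taut} ρ = taut λ v →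
    trans (evalB-instantiate v σ ρ)
          (to T-≡ (all-∈ (evalˢ σ) (allSubsets k) σ-taut (∈-allSubsets _)))

x₀ : ∀ {k} → Schema (1 + k)
x₀ = var fzero

x₁ : ∀ {k} → Schema (2 + k)
x₁ = var (fsuc fzero)

x₂ : ∀ {k} → Schema (3 + k)
x₂ = var (fsuc (fsuc fzero))

x₃ : ∀ {k} → Schema (4 + k)
x₃ = var (fsuc (fsuc (fsuc fzero)))

module Derivations {n m : ℕ} where

  infix 1 ⊢_
  ⊢_ : Form n m → Set
  ⊢ φ = PLC φ

  infixr 2 _⨾_

  private variable
    a b c d : Form n m

  mp₂ : ⊢ a → ⊢ b → ⊢ a ⇒ (b ⇒ c) → ⊢ c
  mp₂ p q r = mp q (mp p r)

  _⨾_ : ⊢ a ⇒ b → ⊢ b ⇒ c → ⊢ a ⇒ c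
  _⨾_ {a} {b} {c} p q =
    mp₂ p q (tautology ((x₀ ⇒ˢ x₁) ⇒ˢ (x₁ ⇒ˢ x₂) ⇒ˢ x₀ ⇒ˢ x₂) (a ∷ b ∷ c ∷ []))

  ⟨_,_⟩ : ⊢ a ⇒ b → ⊢ a ⇒ c → ⊢ a ⇒ b & c
  ⟨_,_⟩ {a} {b} {c} p q =
    mp₂ p q (tautology ((x₀ ⇒ˢ x₁) ⇒ˢ (x₀ ⇒ˢ x₂) ⇒ˢ x₀ ⇒ˢ x₁ ∧ˢ x₂) (a ∷ b ∷ c ∷ []))

  π₁ : ⊢ a & b ⇒ a
  π₁ {a} {b} = tautology (x₀ ∧ˢ x₁ ⇒ˢ x₀) (a ∷ b ∷ [])

  π₂ : ⊢ a & b ⇒ b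
  π₂ {a} {b} = tautology (x₀ ∧ˢ x₁ ⇒ˢ x₁) (a ∷ b ∷ [])

  ⇒-refl : ⊢ a ⇒ a
  ⇒-refl {a} = tautology (x₀ ⇒ˢ x₀) (a ∷ [])

  curry : ⊢ a & b ⇒ c → ⊢ a ⇒ (b ⇒ c)
  curry {a} {b} {c} p = mp p (tautology ((x₀ ∧ˢ x₁ ⇒ˢ x₂) ⇒ˢ x₀ ⇒ˢ x₁ ⇒ˢ x₂) (a ∷ b ∷ c ∷ []))

  uncurry : ⊢ a ⇒ (b ⇒ c) → ⊢ a & b ⇒ c
  uncurry {a} {b} {c} p = mp p (tautology ((x₀ ⇒ˢ x₁ ⇒ˢ x₂) ⇒ˢ x₀ ∧ˢ x₁ ⇒ˢ x₂) (a ∷ b ∷ c ∷ []))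

  contradiction : ⊢ a ⇒ b → ⊢ a ⇒ ~ b → ⊢ a ⇒ c
  contradiction {a} {b} {c} p q =
    mp₂ p q (tautology ((x₀ ⇒ˢ x₁) ⇒ˢ (x₀ ⇒ˢ ¬ˢ x₁) ⇒ˢ x₀ ⇒ˢ x₂) (a ∷ b ∷ c ∷ []))

  ⇒-contrapose : ⊢ (a ⇒ b) ⇒ (~ b ⇒ ~ a)
  ⇒-contrapose {a} {b} = tautology ((x₀ ⇒ˢ x₁) ⇒ˢ ¬ˢ x₁ ⇒ˢ ¬ˢ x₀) (a ∷ b ∷ [])

  contrapose : ⊢ a ⇒ b → ⊢ ~ b ⇒ ~ a
  contrapose p = mp p ⇒-contrapose

  ¬¬-intro : ⊢ a ⇒ ~ ~ a
  ¬¬-intro {a} = tautology (x₀ ⇒ˢ ¬ˢ ¬ˢ x₀) (a ∷ [])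

  ¬¬-elim : ⊢ ~ ~ a ⇒ a
  ¬¬-elim {a} = tautology (¬ˢ ¬ˢ x₀ ⇒ˢ x₀) (a ∷ [])

  &-∨-elim : ⊢ a & b ⇒ d → ⊢ a & c ⇒ d → ⊢ a & (b ∨′ c) ⇒ d
  &-∨-elim {a} {b} {d} {c} p q =
    mp₂ p q (tautology ((x₀ ∧ˢ x₁ ⇒ˢ x₃) ⇒ˢ (x₀ ∧ˢ x₂ ⇒ˢ x₃) ⇒ˢ x₀ ∧ˢ (x₁ ∨ˢ x₂) ⇒ˢ x₃)
                       (a ∷ b ∷ c ∷ d ∷ []))

  ∨-elim : ⊢ a ⇒ c → ⊢ b ⇒ c → ⊢ a ∨′ b ⇒ c
  ∨-elim {a} {c} {b} p q =
    mp₂ p q (tautology ((x₀ ⇒ˢ x₂) ⇒ˢ (x₁ ⇒ˢ x₂) ⇒ˢ x₀ ∨ˢ x₁ ⇒ˢ x₂) (a ∷ b ∷ c ∷ []))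

  ∨-introˡ : ⊢ a ⇒ a ∨′ b
  ∨-introˡ {a} {b} = tautology (x₀ ⇒ˢ x₀ ∨ˢ x₁) (a ∷ b ∷ [])

  ∨-introʳ : ⊢ b ⇒ a ∨′ b
  ∨-introʳ {b} {a} = tautology (x₁ ⇒ˢ x₀ ∨ˢ x₁) (a ∷ b ∷ [])

  weaken : ⊢ b → ⊢ a ⇒ b
  weaken {b} {a} p = mp p (tautology (x₁ ⇒ˢ x₀ ⇒ˢ x₁) (a ∷ b ∷ []))

  falsum-elim : ⊢ falsum a ⇒ c
  falsum-elim {a} {c} = tautology (x₀ ∧ˢ ¬ˢ x₀ ⇒ˢ x₁) (a ∷ c ∷ [])

  verum-intro : ⊢ verum a
  verum-intro {a} = tautology (¬ˢ (x₀ ∧ˢ ¬ˢ x₀)) (a ∷ [])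

  excluded-middle : ⊢ a ∨′ (~ a ∨′ falsum b)
  excluded-middle {a} {b} = tautology (x₀ ∨ˢ (¬ˢ x₀ ∨ˢ x₁ ∧ˢ ¬ˢ x₁)) (a ∷ b ∷ [])

  ¬&-∨ : ⊢ ~ (a & c) ⇒ ~ a ∨′ ~ c
  ¬&-∨ {a} {c} = tautology (¬ˢ (x₀ ∧ˢ x₁) ⇒ˢ ¬ˢ x₀ ∨ˢ ¬ˢ x₁) (a ∷ c ∷ [])

  ¬&-⇒¬ : ⊢ a ⇒ (~ (a & c) ⇒ ~ c)
  ¬&-⇒¬ {a} {c} = tautology (x₀ ⇒ˢ ¬ˢ (x₀ ∧ˢ x₁) ⇒ˢ ¬ˢ x₁) (a ∷ c ∷ [])

  by-cases : ⊢ a ⇒ c → ⊢ ~ a ⇒ c → ⊢ c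
  by-cases {a} {c} p q = mp₂ p q (tautology ((x₀ ⇒ˢ x₁) ⇒ˢ (¬ˢ x₀ ⇒ˢ x₁) ⇒ˢ x₁) (a ∷ c ∷ []))

  ⇒-app : ⊢ a ⇒ b → ⊢ a ⇒ (b ⇒ c) → ⊢ a ⇒ c
  ⇒-app p q = ⟨ ⇒-refl , p ⟩ ⨾ uncurry q

  &-map : ⊢ a ⇒ c → ⊢ b ⇒ d → ⊢ a & b ⇒ c & d
  &-map p q = ⟨ π₁ ⨾ p , π₂ ⨾ q ⟩

  ∨-map : ⊢ a ⇒ c → ⊢ b ⇒ d → ⊢ a ∨′ b ⇒ c ∨′ d
  ∨-map p q = ∨-elim (p ⨾ ∨-introˡ) (q ⨾ ∨-introʳ)

  ◇ : Box → Form n m → Form n m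
  ◇ β a = ~ □ β (~ a)

  private variable
    β β′ : Box

  □-distrib-⇒ : ⊢ □ β (a ⇒ c) ⇒ (□ β a ⇒ □ β c)
  □-distrib-⇒ {β} {a} {c} = curry (⟨ π₂ , π₁ ⟩ ⨾ axK β a c)

  □-mono : ⊢ a ⇒ c → ⊢ □ β a ⇒ □ β c
  □-mono {β = β} p = mp (nec β p) □-distrib-⇒

  □-distrib-& : ⊢ □ β a & □ β c ⇒ □ β (a & c)
  □-distrib-& = uncurry (□-mono (curry ⇒-refl) ⨾ □-distrib-⇒)

  ◇-mono : ⊢ a ⇒ c → ⊢ ◇ β a ⇒ ◇ β c
  ◇-mono p = contrapose (□-mono (contrapose p))

  ◇-intro : ⊢ a ⇒ ◇ β a
  ◇-intro {a} {β} = ¬¬-intro ⨾ contrapose (axT β (~ a))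

  ◇⇒□◇ : ⊢ ◇ β a ⇒ □ β (◇ β a)
  ◇⇒□◇ {β} {a} = ax5 β (~ a)

  ◇□⇒□ : ⊢ ◇ β (□ β a) ⇒ □ β a
  ◇□⇒□ {β} {a} = contrapose (ax5 β a) ⨾ ¬¬-elim

  ◇¬⇒¬□ : ⊢ ◇ β (~ a) ⇒ ~ □ β a
  ◇¬⇒¬□ = contrapose (□-mono ¬¬-intro)

  □-&-◇ : ⊢ □ β a & ◇ β c ⇒ ◇ β (a & c)
  □-&-◇ = uncurry (□-mono ¬&-⇒¬ ⨾ □-distrib-⇒ ⨾ ⇒-contrapose)

  ◇-distrib-∨ : ⊢ ◇ β (a ∨′ c) ⇒ ◇ β a ∨′ ◇ β c
  ◇-distrib-∨ = contrapose (□-distrib-& ⨾ □-mono ¬¬-intro) ⨾ ¬&-∨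

  ⇒□◇ : ⊢ a ⇒ □ β (◇ β a)
  ⇒□◇ = ◇-intro ⨾ ◇⇒□◇

  ◇□⇒□◇ : (∀ a → ⊢ □ β′ (□ β a) ⇒ □ β (□ β′ a)) → ⊢ ◇ β (□ β′ a) ⇒ □ β′ (◇ β a)
  ◇□⇒□◇ {β′} {β} {a} commute = ◇-mono (□-mono ⇒□◇ ⨾ commute (◇ β a)) ⨾ ◇□⇒□ ⨾ axT β _

  □F□I⇒□I□F : ∀ a → ⊢ □ F (□ I a) ⇒ □ I (□ F a)
  □F□I⇒□I□F a = mp (comm a) π₁

  □I□F⇒□F□I : ∀ a → ⊢ □ I (□ F a) ⇒ □ F (□ I a)
  □I□F⇒□F□I a = mp (comm a) π₂

  Stable : Box → Form n m → Set
  Stable β a = ⊢ a ⇒ □ β a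

  ¬◇-stable : Stable β (~ ◇ β a)
  ¬◇-stable {β} {a} = ¬¬-elim ⨾ ax4 β (~ a) ⨾ □-mono ¬¬-intro

  &-stable : Stable β a → Stable β c → Stable β (a & c)
  &-stable p q = &-map p q ⨾ □-distrib-&

  literal : Form n m → Bool → Form n m
  literal a b = if b then a else ~ a

  literal-by-cases : ∀ b → (T b → ⊢ c ⇒ a) → (¬ T b → ⊢ c ⇒ ~ a) → ⊢ c ⇒ literal a b
  literal-by-cases true p q = p _
  literal-by-cases false p q = q λ ()

  literal-true : ∀ {b} → T b → ⊢ literal a b ⇒ a
  literal-true {b = true} _ = ⇒-refl

  literal-false : ∀ {b} → ¬ T b → ⊢ literal a b ⇒ ~ a
  literal-false {b = true} ¬b = ⊥-elim (¬b _)
  literal-false {b = false} _ = ⇒-refl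

  literal-~ : ∀ b → ⊢ literal a b ⇒ literal (~ a) (not b)
  literal-~ true = ¬¬-intro
  literal-~ false = ⇒-refl

  literal-& : ∀ b b′ → ⊢ literal a b & literal c b′ ⇒ literal (a & c) (b ∧ b′)
  literal-& true true = ⇒-refl
  literal-& true false = π₂ ⨾ contrapose π₂
  literal-& false _ = π₁ ⨾ contrapose π₁

  literal-stable : Stable β a → Stable β (~ a) → ∀ b → Stable β (literal a b)
  literal-stable p q true = p
  literal-stable p q false = q

  ◇-literal-stable : ∀ b → Stable β (literal (◇ β a) b)
  ◇-literal-stable = literal-stable ◇⇒□◇ ¬◇-stable

  ◇I-literal-F-stable : Stable F a → Stable F (~ a) → ∀ b → Stable F (literal (◇ I a) b)
  ◇I-literal-F-stable a-stable ¬a-stable = literal-stable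
    (◇-mono a-stable ⨾ ◇□⇒□◇ □F□I⇒□I□F)
    (¬¬-elim ⨾ □-mono ¬a-stable ⨾ □I□F⇒□F□I _ ⨾ □-mono ¬¬-intro)

  ◇F□I-literal-I-stable : ∀ b → Stable I (literal (◇ F (□ I a)) b)
  ◇F□I-literal-I-stable {a} = literal-stable
    (◇-mono (ax4 I a) ⨾ ◇□⇒□◇ □I□F⇒□F□I)
    (¬¬-elim ⨾ □-mono (ax5 I a) ⨾ □F□I⇒□I□F _ ⨾ □-mono ¬¬-intro)

module FiniteConnectives {n m : ℕ} (ψ₀ : Form n m) where
  open Derivations

  ⋀ ⋁ : {A : Set} → (A → Form n m) → List A → Form n m
  ⋀ h xs = bigAnd ψ₀ (map h xs)
  ⋁ h xs = bigOr ψ₀ (map h xs)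

  private variable
    A : Set
    h h′ : A → Form n m
    a c : Form n m
    β : Box
    x : A
    xs : List A

  ⋀-elim : x ∈ xs → ⊢ ⋀ h xs ⇒ h x
  ⋀-elim (here refl) = π₁
  ⋀-elim (there x∈xs) = π₂ ⨾ ⋀-elim x∈xs

  ⋀-intro : ∀ xs → (∀ {x} → x ∈ xs → ⊢ a ⇒ h x) → ⊢ a ⇒ ⋀ h xs
  ⋀-intro [] f = weaken verum-intro
  ⋀-intro (x ∷ xs) f = ⟨ f (here refl) , ⋀-intro xs (f ∘ there) ⟩

  ⋁-intro : x ∈ xs → ⊢ h x ⇒ ⋁ h xs
  ⋁-intro (here refl) = ∨-introˡ
  ⋁-intro (there x∈xs) = ⋁-intro x∈xs ⨾ ∨-introʳ

  &-⋁-elim : ∀ xs → (∀ {x} → x ∈ xs → ⊢ a & h x ⇒ c) → ⊢ a & ⋁ h xs ⇒ c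
  &-⋁-elim [] f = π₂ ⨾ falsum-elim
  &-⋁-elim (x ∷ xs) f = &-∨-elim (f (here refl)) (&-⋁-elim xs (f ∘ there))

  ⋁-cases : ⊢ a ⇒ ⋁ h xs → (∀ {x} → x ∈ xs → ⊢ a & h x ⇒ c) → ⊢ a ⇒ c
  ⋁-cases {xs = xs} p f = ⟨ ⇒-refl , p ⟩ ⨾ &-⋁-elim xs f

  ⋀-map : ∀ xs → (∀ x → ⊢ h x ⇒ h′ x) → ⊢ ⋀ h xs ⇒ ⋀ h′ xs
  ⋀-map [] f = ⇒-refl
  ⋀-map (x ∷ xs) f = &-map (f x) (⋀-map xs f)

  ⋁-map : ∀ xs → (∀ x → ⊢ h x ⇒ h′ x) → ⊢ ⋁ h xs ⇒ ⋁ h′ xs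
  ⋁-map [] f = ⇒-refl
  ⋁-map (x ∷ xs) f = ∨-map (f x) (⋁-map xs f)

  ⋀-□ : ∀ xs → ⊢ ⋀ (λ x → □ β (h x)) xs ⇒ □ β (⋀ h xs)
  ⋀-□ {β = β} [] = weaken (nec β verum-intro)
  ⋀-□ (x ∷ xs) = &-map ⇒-refl (⋀-□ xs) ⨾ □-distrib-&

  ⋀-stable : ∀ xs → (∀ x → Stable β (h x)) → Stable β (⋀ h xs)
  ⋀-stable xs f = ⋀-map xs f ⨾ ⋀-□ xs

  ◇-⋀ : ∀ xs → (∀ x → ⊢ ◇ β (h x) ⇒ h x) → ⊢ ◇ β (⋀ h xs) ⇒ ⋀ h xs
  ◇-⋀ [] f = weaken verum-intro
  ◇-⋀ (x ∷ xs) f = ⟨ ◇-mono π₁ ⨾ f x , ◇-mono π₂ ⨾ ◇-⋀ xs f ⟩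

  ◇-distrib-⋁ : ∀ xs → ⊢ ◇ β (⋁ h xs) ⇒ ⋁ (λ x → ◇ β (h x)) xs
  ◇-distrib-⋁ {β = β} [] = contradiction (weaken (nec β verum-intro)) ⇒-refl
  ◇-distrib-⋁ (x ∷ xs) = ◇-distrib-∨ ⨾ ∨-map ⇒-refl (◇-distrib-⋁ xs)

  ⋁-&-distrib : ∀ xs → ⊢ ⋁ h xs & c ⇒ ⋁ (λ x → h x & c) xs
  ⋁-&-distrib xs = ⟨ π₂ , π₁ ⟩ ⨾ &-⋁-elim xs (λ x∈xs → ⟨ π₂ , π₁ ⟩ ⨾ ⋁-intro x∈xs)

  evalB-⋁ : ∀ v {h : A → Form n m} → x ∈ xs → evalB v (h x) ≡ true → evalB v (⋁ h xs) ≡ true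
  evalB-⋁ v (here refl) hx-true rewrite hx-true = refl
  evalB-⋁ v {h} (there {x = y} x∈xs) hx-true
    rewrite evalB-⋁ v {h} x∈xs hx-true | ∧-zeroʳ (not (evalB v (h y))) = refl

  evalB-⋀ : ∀ v xs → (∀ {x} → x ∈ xs → evalB v (h x) ≡ true) → evalB v (⋀ h xs) ≡ true
  evalB-⋀ v [] _ with evalB v ψ₀
  ... | true = refl
  ... | false = refl
  evalB-⋀ v (x ∷ xs) all-true rewrite all-true (here refl) = evalB-⋀ v xs (all-true ∘ there)

  literal-excluded-middle : ∀ θ → ⊢ ⋁ (literal θ) (true ∷ false ∷ [])
  literal-excluded-middle θ = excluded-middle

  override : {O : Set} → DecidableEquality A → A → O → (A → O) → A → O
  override _≟_ a o c x with x ≟ a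
  ... | yes _ = o
  ... | no _ = c x

  -- The distributive law ⋀_a ⋁_o ψ a o ⇒ ⋁_c ⋀_a ψ a (c a), phrased as an elimination rule;
  -- o₀ is only the value of the choice functions c outside the list as.
  finite-choice : {O : Set} → DecidableEquality A → O → (ψ : A → O → Form n m) (os : List O) →
                  (∀ a → ⊢ ⋁ (ψ a) os) → ∀ (as : List A) {Γ φ} →
                  ((c : A → O) → ⊢ Γ & ⋀ (λ a → ψ a (c a)) as ⇒ φ) → ⊢ Γ ⇒ φ
  finite-choice _≟_ o₀ ψ os total [] H = ⟨ ⇒-refl , weaken verum-intro ⟩ ⨾ H (λ _ → o₀)
  finite-choice _≟_ o₀ ψ os total (a ∷ as) {Γ} H =
    ⋁-cases {xs = os} (weaken (total a)) λ {o} _ →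
      finite-choice _≟_ o₀ ψ os total as λ c →
        ⟨ π₁ ⨾ π₁ , ⋀-intro (a ∷ as) (pick o c) ⟩ ⨾ H (override _≟_ a o c)
    where
      pick : ∀ o c {x} → x ∈ a ∷ as →
             ⊢ (Γ & ψ a o) & ⋀ (λ a → ψ a (c a)) as ⇒ ψ x (override _≟_ a o c x)
      pick o c {x} x∈ with x ≟ a | x∈
      ... | yes refl | _ = π₁ ⨾ π₂
      ... | no x≢a | here x≡a = ⊥-elim (x≢a x≡a)
      ... | no _ | there x∈as = π₂ ⨾ ⋀-elim x∈as

-- Functions on Vec Bool k stored as complete binary tries, so that they can be enumerated.
Table : ℕ → Set → Set
Table zero A = A
Table (suc k) A = Table k A × Table k A

module _ {A : Set} where

  _!_ : ∀ {k} → Table k A → Vec Bool k → A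
  _!_ {zero} a [] = a
  _!_ {suc k} (l , r) (true ∷ X) = l ! X
  _!_ {suc k} (l , r) (false ∷ X) = r ! X

  tabulateᵀ : ∀ {k} → (Vec Bool k → A) → Table k A
  tabulateᵀ {zero} c = c []
  tabulateᵀ {suc k} c = tabulateᵀ (c ∘ (true ∷_)) , tabulateᵀ (c ∘ (false ∷_))

  !-tabulateᵀ : ∀ {k} (c : Vec Bool k → A) X → tabulateᵀ c ! X ≡ c X
  !-tabulateᵀ {zero} c [] = refl
  !-tabulateᵀ {suc k} c (true ∷ X) = !-tabulateᵀ (c ∘ (true ∷_)) X
  !-tabulateᵀ {suc k} c (false ∷ X) = !-tabulateᵀ (c ∘ (false ∷_)) X

  allTables : ∀ k → List A → List (Table k A)
  allTables zero as = as
  allTables (suc k) as = cartesianProduct (allTables k as) (allTables k as)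

  ∈-allTables : ∀ k {as : List A} → (∀ a → a ∈ as) → (g : Table k A) → g ∈ allTables k as
  ∈-allTables zero ∈as g = ∈as g
  ∈-allTables (suc k) ∈as (l , r) =
    ∈-cartesianProduct⁺ (∈-allTables k ∈as l) (∈-allTables k ∈as r)

  ≡-decᵀ : ∀ k → DecidableEquality A → DecidableEquality (Table k A)
  ≡-decᵀ zero _≟_ = _≟_
  ≡-decᵀ (suc k) _≟_ = ≡-dec (≡-decᵀ k _≟_) (≡-decᵀ k _≟_)

module Completeness {n m : ℕ} (ψ₀ : Form n m) where
  open Derivations {n} {m}
  open FiniteConnectives ψ₀

  Assignment : Set
  Assignment = Vec Bool n

  cnₓ : Assignment → Form n m
  cnₓ = cn ψ₀

  cn-exhaustive : ⊢ ⋁ cnₓ (allSubsets n)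
  cn-exhaustive = taut λ v →
    let X = Vec.tabulate (v ∘ atom) in
    evalB-⋁ v (∈-allSubsets X) (evalB-⋀ v (allFin n) λ {i} _ →
      lit-true v i (lookup∘tabulate (v ∘ atom) i))
    where
      lit-true : ∀ v i {b} → b ≡ v (atom i) → evalB v (if b then atom i else ~ atom i) ≡ true
      lit-true v i {true} b≡ = sym b≡
      lit-true v i {false} b≡ rewrite sym b≡ = refl

  Computes : Table n (Fin m) → Form n m
  Computes g = □ I (⋀ (λ X → cnₓ X ⇒ t (g ! X)) (allSubsets n))

  value-determined : ∀ X → ⊢ ⋁ (λ x → □ I (cnₓ X ⇒ t x)) (allFin m)
  value-determined X = by-cases realised unrealised
    where
      realised : ⊢ ◇ I (cnₓ X) ⇒ ⋁ (λ x → □ I (cnₓ X ⇒ t x)) (allFin m)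
      realised = ⟨ weaken (nec I (atLeast ψ₀)) , ⇒-refl ⟩ ⨾ □-&-◇
               ⨾ ◇-mono (⋁-&-distrib (allFin m)) ⨾ ◇-distrib-⋁ (allFin m)
               ⨾ ⋁-map (allFin m) λ x → ◇-mono (⟨ π₂ , π₁ ⟩ ⨾ funct ψ₀ X x) ⨾ ◇□⇒□
      unrealised : ⊢ ~ ◇ I (cnₓ X) ⇒ ⋁ (λ x → □ I (cnₓ X ⇒ t x)) (allFin m)
      unrealised = ⋁-cases {xs = allFin m} (weaken (atLeast ψ₀)) λ x∈ →
                     π₁ ⨾ ¬¬-elim ⨾ □-mono (contrapose π₁) ⨾ ⋁-intro x∈

  computes-cases : ∀ {Γ φ} → Fin m → ((g : Table n (Fin m)) → ⊢ Γ & Computes g ⇒ φ) → ⊢ Γ ⇒ φ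
  computes-cases x₀ H =
    finite-choice (≡-decⱽ Bool._≟_) x₀ (λ X x → □ I (cnₓ X ⇒ t x)) (allFin m) value-determined
      (allSubsets n) λ c →
        &-map ⇒-refl (⋀-□ (allSubsets n) ⨾ □-mono (⋀-map (allSubsets n) (graph c))) ⨾ H (tabulateᵀ c)
    where
      graph : ∀ c X → ⊢ (cnₓ X ⇒ t (c X)) ⇒ (cnₓ X ⇒ t (tabulateᵀ c ! X))
      graph c X rewrite !-tabulateᵀ c X = ⇒-refl

  atom-F-stable : ∀ b i → Stable F (literal (atom i) b)
  atom-F-stable true = indep+
  atom-F-stable false = indep-

  ◇F-atom : ∀ b i → ⊢ ◇ F (literal (atom i) b) ⇒ literal (atom i) b
  ◇F-atom true i = contrapose (indep- i) ⨾ ¬¬-elim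
  ◇F-atom false i = contrapose (indep+ i ⨾ □-mono ¬¬-intro)

  cn-F-stable : ∀ X → Stable F (cnₓ X)
  cn-F-stable X = ⋀-stable (allFin n) λ i → atom-F-stable (lookup X i) i

  ¬cn-F-stable : ∀ X → Stable F (~ cnₓ X)
  ¬cn-F-stable X = contrapose (◇-⋀ (allFin n) λ i → ◇F-atom (lookup X i) i) ⨾ ¬¬-elim

  tables : List (Table n (Fin m))
  tables = allTables n (allFin m)

  ∈-tables : ∀ g → g ∈ tables
  ∈-tables = ∈-allTables n ∈-allFin

  module Diagram (S : Assignment → Bool) (G : Table n (Fin m) → Bool) where

    Realised Admissible Diagram : Form n m
    Realised = ⋀ (λ X → literal (◇ I (cnₓ X)) (S X)) (allSubsets n)
    Admissible = ⋀ (λ g → literal (◇ F (Computes g)) (G g)) tables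
    Diagram = Realised & Admissible

    diagram-I-stable : Stable I Diagram
    diagram-I-stable = &-stable
      (⋀-stable (allSubsets n) λ X → ◇-literal-stable (S X))
      (⋀-stable tables λ g → ◇F□I-literal-I-stable (G g))

    diagram-F-stable : Stable F Diagram
    diagram-F-stable = &-stable
      (⋀-stable (allSubsets n) λ X → ◇I-literal-F-stable (cn-F-stable X) (¬cn-F-stable X) (S X))
      (⋀-stable tables λ g → ◇-literal-stable (G g))

    realised : ∀ X → ⊢ Diagram ⇒ literal (◇ I (cnₓ X)) (S X)
    realised X = π₁ ⨾ ⋀-elim (∈-allSubsets X)

    admissible : ∀ g → ⊢ Diagram ⇒ literal (◇ F (Computes g)) (G g)
    admissible g = π₂ ⨾ ⋀-elim (∈-tables g)

    unrealised-absurd : ∀ {X c} → ¬ T (S X) → ⊢ Diagram & cnₓ X ⇒ c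
    unrealised-absurd {X} ¬SX = contradiction (π₂ ⨾ ◇-intro) (π₁ ⨾ realised X ⨾ literal-false ¬SX)

    inadmissible-absurd : ∀ {g c} → ¬ T (G g) → ⊢ Diagram & Computes g ⇒ c
    inadmissible-absurd {g} ¬Gg = contradiction (π₂ ⨾ ◇-intro) (π₁ ⨾ admissible g ⨾ literal-false ¬Gg)

    realisedAssignments : List Assignment
    realisedAssignments = filterᵇ S (allSubsets n)

    admissibleTables : List (Table n (Fin m))
    admissibleTables = filterᵇ G tables

    ⟦_⟧ : Form n m → Assignment → Table n (Fin m) → Bool
    ⟦ atom i ⟧ X g = lookup X i
    ⟦ t x ⟧ X g = ⌊ g ! X ≟ x ⌋
    ⟦ ~ φ ⟧ X g = not (⟦ φ ⟧ X g)
    ⟦ φ & ψ ⟧ X g = ⟦ φ ⟧ X g ∧ ⟦ ψ ⟧ X g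
    ⟦ □ I φ ⟧ X g = all (λ X′ → ⟦ φ ⟧ X′ g) realisedAssignments
    ⟦ □ F φ ⟧ X g = all (λ g′ → ⟦ φ ⟧ X g′) admissibleTables

    □I-elim : ∀ φ {X X′ g} → T (⟦ □ I φ ⟧ X g) → T (S X′) → T (⟦ φ ⟧ X′ g)
    □I-elim φ {X′ = X′} {g} all-φ SX′ =
      all-∈ (λ X′ → ⟦ φ ⟧ X′ g) realisedAssignments all-φ (∈-filter⁺ (T? ∘ S) (∈-allSubsets X′) SX′)

    □I-counterexample : ∀ φ {X g} → ¬ T (⟦ □ I φ ⟧ X g) → ∃ λ X′ → T (S X′) × ¬ T (⟦ φ ⟧ X′ g)
    □I-counterexample φ {g = g} ¬all-φ with ¬all-∈ (λ X′ → ⟦ φ ⟧ X′ g) realisedAssignments ¬all-φ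
    ... | X′ , X′∈ , ¬φX′ = X′ , proj₂ (∈-filter⁻ (T? ∘ S) {xs = allSubsets n} X′∈) , ¬φX′

    □F-elim : ∀ φ {X g g′} → T (⟦ □ F φ ⟧ X g) → T (G g′) → T (⟦ φ ⟧ X g′)
    □F-elim φ {X} {g′ = g′} all-φ Gg′ =
      all-∈ (⟦ φ ⟧ X) admissibleTables all-φ (∈-filter⁺ (T? ∘ G) (∈-tables g′) Gg′)

    □F-counterexample : ∀ φ {X g} → ¬ T (⟦ □ F φ ⟧ X g) → ∃ λ g′ → T (G g′) × ¬ T (⟦ φ ⟧ X g′)
    □F-counterexample φ {X} ¬all-φ with ¬all-∈ (⟦ φ ⟧ X) admissibleTables ¬all-φ
    ... | g′ , g′∈ , ¬φg′ = g′ , proj₂ (∈-filter⁻ (T? ∘ G) {xs = tables} g′∈) , ¬φg′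

    Point : Assignment → Table n (Fin m) → Form n m
    Point X g = (Diagram & cnₓ X) & Computes g

    value : ∀ X g → ⊢ Point X g ⇒ t (g ! X)
    value X g = ⇒-app (π₁ ⨾ π₂) (π₂ ⨾ axT I _ ⨾ ⋀-elim (∈-allSubsets X))

    truth : ∀ φ X g → ⊢ Point X g ⇒ literal φ (⟦ φ ⟧ X g)
    truth (atom i) X g = π₁ ⨾ π₂ ⨾ ⋀-elim (∈-allFin i)
    truth (t x) X g with g ! X ≟ x
    ... | yes refl = value X g
    ... | no g!X≢x = value X g ⨾ atMost (g ! X) x g!X≢x
    truth (~ φ) X g = truth φ X g ⨾ literal-~ (⟦ φ ⟧ X g)
    truth (φ & ψ) X g = ⟨ truth φ X g , truth ψ X g ⟩ ⨾ literal-& (⟦ φ ⟧ X g) (⟦ ψ ⟧ X g)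
    truth (□ I φ) X g = literal-by-cases (⟦ □ I φ ⟧ X g) holds fails
      where
        rest-stable : Stable I (Diagram & Computes g)
        rest-stable = &-stable diagram-I-stable (ax4 I _)

        regroup : ∀ {X′} → ⊢ (Diagram & Computes g) & cnₓ X′ ⇒ Point X′ g
        regroup = ⟨ ⟨ π₁ ⨾ π₁ , π₂ ⟩ , π₁ ⨾ π₂ ⟩

        holds : T (⟦ □ I φ ⟧ X g) → ⊢ Point X g ⇒ □ I φ
        holds all-φ = ⟨ π₁ ⨾ π₁ , π₂ ⟩ ⨾ rest-stable
                    ⨾ □-mono (⋁-cases {xs = allSubsets n} (weaken cn-exhaustive) λ {X′} _ →
                                regroup {X′} ⨾ at X′)
          where
            at : ∀ X′ → ⊢ Point X′ g ⇒ φ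
            at X′ with T? (S X′)
            ... | yes SX′ = truth φ X′ g ⨾ literal-true (□I-elim φ {X} all-φ SX′)
            ... | no ¬SX′ = π₁ ⨾ unrealised-absurd ¬SX′

        fails : ¬ T (⟦ □ I φ ⟧ X g) → ⊢ Point X g ⇒ ~ □ I φ
        fails ¬all-φ with □I-counterexample φ {X} ¬all-φ
        ... | X′ , SX′ , ¬φX′ =
          ⟨ ⟨ π₁ ⨾ π₁ , π₂ ⟩ ⨾ rest-stable , π₁ ⨾ π₁ ⨾ realised X′ ⨾ literal-true SX′ ⟩
          ⨾ □-&-◇ ⨾ ◇-mono (regroup {X′} ⨾ truth φ X′ g ⨾ literal-false ¬φX′) ⨾ ◇¬⇒¬□
    truth (□ F φ) X g = literal-by-cases (⟦ □ F φ ⟧ X g) holds fails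
      where
        here-stable : Stable F (Diagram & cnₓ X)
        here-stable = &-stable diagram-F-stable (cn-F-stable X)

        holds : T (⟦ □ F φ ⟧ X g) → ⊢ Point X g ⇒ □ F φ
        holds all-φ = π₁ ⨾ here-stable ⨾ □-mono (computes-cases (g ! X) at)
          where
            at : ∀ g′ → ⊢ Point X g′ ⇒ φ
            at g′ with T? (G g′)
            ... | yes Gg′ = truth φ X g′ ⨾ literal-true (□F-elim φ {g = g} all-φ Gg′)
            ... | no ¬Gg′ = ⟨ π₁ ⨾ π₁ , π₂ ⟩ ⨾ inadmissible-absurd ¬Gg′

        fails : ¬ T (⟦ □ F φ ⟧ X g) → ⊢ Point X g ⇒ ~ □ F φ
        fails ¬all-φ with □F-counterexample φ {g = g} ¬all-φ
        ... | g′ , Gg′ , ¬φg′ =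
          ⟨ π₁ ⨾ here-stable , π₁ ⨾ π₁ ⨾ admissible g′ ⨾ literal-true Gg′ ⟩
          ⨾ □-&-◇ ⨾ ◇-mono (truth φ X g′ ⨾ literal-false ¬φg′) ⨾ ◇¬⇒¬□

    model : MCM n m
    model = record
      { S = S
      ; Φ = λ f → Σ (Table n (Fin m)) λ g → T (G g) × (∀ s → f s ≡ g ! proj₁ s)
      }

    model-truth : ∀ φ s f g → (∀ s → f s ≡ g ! proj₁ s) →
                  (model , s , f ⊨ φ) ⇔ T (⟦ φ ⟧ (proj₁ s) g)
    model-truth (atom i) s f g f≗g = mk⇔ (λ p → p) (λ p → p)
    model-truth (t x) s f g f≗g =
      mk⇔ (λ fs≡x → fromWitness {a? = g ! proj₁ s ≟ x} (trans (sym (f≗g s)) fs≡x))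
          (λ g!X≡x → trans (f≗g s) (toWitness {a? = g ! proj₁ s ≟ x} g!X≡x))
    model-truth (~ φ) s f g f≗g =
      mk⇔ (λ ¬φ → to T-not (¬φ ∘ from IH)) (λ ¬φ → from T-not ¬φ ∘ to IH)
      where IH = model-truth φ s f g f≗g
    model-truth (φ & ψ) s f g f≗g =
      mk⇔ (λ (p , q) → from T-∧ (to IH₁ p , to IH₂ q))
          (λ pq → let (p , q) = to T-∧ pq in from IH₁ p , from IH₂ q)
      where IH₁ = model-truth φ s f g f≗g
            IH₂ = model-truth ψ s f g f≗g
    model-truth (□ I φ) s f g f≗g =
      mk⇔ (λ □φ → all⁻ (λ X′ → ⟦ φ ⟧ X′ g) (All.tabulate λ X′∈ →
             to (model-truth φ (_ , proj₂ (∈-filter⁻ (T? ∘ S) {xs = allSubsets n} X′∈)) f g f≗g) (□φ _)))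
          (λ all-φ s′ → from (model-truth φ s′ f g f≗g) (□I-elim φ {proj₁ s} all-φ (proj₂ s′)))
    model-truth (□ F φ) s f g f≗g =
      mk⇔ (λ □φ → all⁻ (⟦ φ ⟧ (proj₁ s)) (All.tabulate λ {g′} g′∈ →
             to (model-truth φ s (λ s → g′ ! proj₁ s) g′ λ _ → refl)
                (□φ _ (g′ , proj₂ (∈-filter⁻ (T? ∘ G) {xs = tables} g′∈) , λ _ → refl))))
          (λ { all-φ f′ (g′ , Gg′ , f′≗g′) →
                 from (model-truth φ s f′ g′ f′≗g′) (□F-elim φ {g = g} all-φ Gg′) })

    valid⇒derivable-at : ∀ φ → Valid φ → ∀ X g → ⊢ Point X g ⇒ φ
    valid⇒derivable-at φ valid X g with T? (S X) | T? (G g)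
    ... | no ¬SX | _ = π₁ ⨾ unrealised-absurd ¬SX
    ... | yes _ | no ¬Gg = ⟨ π₁ ⨾ π₁ , π₂ ⟩ ⨾ inadmissible-absurd ¬Gg
    ... | yes SX | yes Gg =
      truth φ X g ⨾ literal-true (to (model-truth φ (X , SX) f g λ _ → refl) φ-true)
      where
        f : State model → Fin m
        f s = g ! proj₁ s
        φ-true : model , (X , SX) , f ⊨ φ
        φ-true = valid model (X , SX) f (g , Gg , λ _ → refl)

  complete : Fin m → (φ : Form n m) → Valid φ → ⊢ φ
  complete x₀ φ valid = mp (verum-intro {a = ψ₀})
    (finite-choice (≡-decⱽ Bool._≟_) true (λ X → literal (◇ I (cnₓ X))) (true ∷ false ∷ [])
       (λ X → literal-excluded-middle _) (allSubsets n) λ S →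
     finite-choice (≡-decᵀ n _≟_) true (λ g → literal (◇ F (Computes g))) (true ∷ false ∷ [])
       (λ g → literal-excluded-middle _) tables λ G →
     ⋁-cases {xs = allSubsets n} (weaken cn-exhaustive) λ {X} _ →
     computes-cases x₀ λ g →
       ⟨ ⟨ ⟨ π₁ ⨾ π₁ ⨾ π₁ ⨾ π₂ , π₁ ⨾ π₁ ⨾ π₂ ⟩ , π₁ ⨾ π₂ ⟩ , π₂ ⟩
       ⨾ Diagram.valid⇒derivable-at S G φ valid X g)

_≟ᴮ_ : DecidableEquality Box
I ≟ᴮ I = yes refl
I ≟ᴮ F = no λ ()
F ≟ᴮ I = no λ ()
F ≟ᴮ F = yes refl

_≟ᶠ_ : ∀ {n m} → DecidableEquality (Form n m)
atom i ≟ᶠ atom j with i ≟ j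
... | yes refl = yes refl
... | no i≢j = no λ { refl → i≢j refl }
t x ≟ᶠ t y with x ≟ y
... | yes refl = yes refl
... | no x≢y = no λ { refl → x≢y refl }
(~ a) ≟ᶠ (~ b) with a ≟ᶠ b
... | yes refl = yes refl
... | no a≢b = no λ { refl → a≢b refl }
(a & a′) ≟ᶠ (b & b′) with a ≟ᶠ b | a′ ≟ᶠ b′
... | yes refl | yes refl = yes refl
... | no a≢b | _ = no λ { refl → a≢b refl }
... | yes _ | no a′≢b′ = no λ { refl → a′≢b′ refl }
□ β a ≟ᶠ □ β′ b with β ≟ᴮ β′ | a ≟ᶠ b
... | yes refl | yes refl = yes refl
... | no β≢β′ | _ = no λ { refl → β≢β′ refl }
... | yes _ | no a≢b = no λ { refl → a≢b refl }
atom _ ≟ᶠ t _ = no λ ()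
atom _ ≟ᶠ (~ _) = no λ ()
atom _ ≟ᶠ (_ & _) = no λ ()
atom _ ≟ᶠ □ _ _ = no λ ()
t _ ≟ᶠ atom _ = no λ ()
t _ ≟ᶠ (~ _) = no λ ()
t _ ≟ᶠ (_ & _) = no λ ()
t _ ≟ᶠ □ _ _ = no λ ()
(~ _) ≟ᶠ atom _ = no λ ()
(~ _) ≟ᶠ t _ = no λ ()
(~ _) ≟ᶠ (_ & _) = no λ ()
(~ _) ≟ᶠ □ _ _ = no λ ()
(_ & _) ≟ᶠ atom _ = no λ ()
(_ & _) ≟ᶠ t _ = no λ ()
(_ & _) ≟ᶠ (~ _) = no λ ()
(_ & _) ≟ᶠ □ _ _ = no λ ()
□ _ _ ≟ᶠ atom _ = no λ ()
□ _ _ ≟ᶠ t _ = no λ ()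
□ _ _ ≟ᶠ (~ _) = no λ ()
□ _ _ ≟ᶠ (_ & _) = no λ ()

-- The formulas that evalB treats as propositional variables.
variables : ∀ {n m} → Form n m → List (Form n m)
variables (~ φ) = variables φ
variables (φ & ψ) = variables φ ++ variables ψ
variables φ = φ ∷ []

module Soundness {n m : ℕ} (Γ : MCM n m) where

  private variable
    s : State Γ
    f : State Γ → Fin m

  ⊨-stable : ∀ φ → ¬ ¬ (Γ , s , f ⊨ φ) → Γ , s , f ⊨ φ
  ⊨-stable {s} (atom i) ¬¬p with lookup (proj₁ s) i
  ... | true = _
  ... | false = ⊥-elim (¬¬p λ ())
  ⊨-stable {s} {f} (t x) ¬¬p with f s ≟ x
  ... | yes p = p
  ... | no ¬p = ⊥-elim (¬¬p ¬p)
  ⊨-stable (~ φ) ¬¬¬p p = ¬¬¬p λ ¬p → ¬p p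
  ⊨-stable (φ & ψ) ¬¬p =
    ⊨-stable φ (λ ¬p → ¬¬p (¬p ∘ proj₁)) , ⊨-stable ψ (λ ¬q → ¬¬p (¬q ∘ proj₂))
  ⊨-stable (□ I φ) ¬¬p s′ = ⊨-stable φ λ ¬p → ¬¬p λ □p → ¬p (□p s′)
  ⊨-stable (□ F φ) ¬¬p f′ Φf′ = ⊨-stable φ λ ¬p → ¬¬p λ □p → ¬p (□p f′ Φf′)

  ⊨-mp : ∀ φ ψ → Γ , s , f ⊨ φ ⇒ ψ → Γ , s , f ⊨ φ → Γ , s , f ⊨ ψ
  ⊨-mp φ ψ φ⇒ψ p = ⊨-stable ψ λ ¬q → φ⇒ψ (p , ¬q)

  module _ (s : State Γ) (f : State Γ → Fin m) where

    Decisions : List (Form n m) → Set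
    Decisions [] = ⊤
    Decisions (ψ ∷ ψs) = Dec (Γ , s , f ⊨ ψ) × Decisions ψs

    ¬¬-decisions : ∀ ψs → ¬ ¬ Decisions ψs
    ¬¬-decisions [] ¬ds = ¬ds _
    ¬¬-decisions (ψ ∷ ψs) ¬ds = ¬¬-decisions ψs λ ds →
      ¬ds (no (λ p → ¬¬-decisions ψs λ ds′ → ¬ds (yes p , ds′)) , ds)

    valuation : ∀ ψs → Decisions ψs → Form n m → Bool
    valuation [] _ ψ = false
    valuation (ψ′ ∷ ψs) (d , ds) ψ with ψ ≟ᶠ ψ′
    ... | yes _ = ⌊ d ⌋
    ... | no _ = valuation ψs ds ψ

    valuation-correct : ∀ ψs ds {ψ} → ψ ∈ ψs → T (valuation ψs ds ψ) ⇔ (Γ , s , f ⊨ ψ)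
    valuation-correct (ψ′ ∷ ψs) (d , ds) {ψ} ψ∈ with ψ ≟ᶠ ψ′ | ψ∈
    ... | yes refl | _ = mk⇔ toWitness fromWitness
    ... | no ψ≢ψ′ | here ψ≡ψ′ = ⊥-elim (ψ≢ψ′ ψ≡ψ′)
    ... | no _ | there ψ∈ψs = valuation-correct ψs ds ψ∈ψs

  evalB-correct : ∀ φ v → (∀ {ψ} → ψ ∈ variables φ → T (v ψ) ⇔ (Γ , s , f ⊨ ψ)) →
                  T (evalB v φ) ⇔ (Γ , s , f ⊨ φ)
  evalB-correct (atom i) v agree = agree (here refl)
  evalB-correct (t x) v agree = agree (here refl)
  evalB-correct (□ β φ) v agree = agree (here refl)
  evalB-correct (~ φ) v agree =
    mk⇔ (λ ¬b → from T-not ¬b ∘ from IH) (λ ¬p → to T-not (¬p ∘ to IH))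
    where IH = evalB-correct φ v agree
  evalB-correct (φ & ψ) v agree =
    mk⇔ (λ pq → let (p , q) = to T-∧ pq in to IH₁ p , to IH₂ q)
        (λ (p , q) → from T-∧ (from IH₁ p , from IH₂ q))
    where IH₁ = evalB-correct φ v (agree ∘ ∈-++⁺ˡ)
          IH₂ = evalB-correct ψ v (agree ∘ ∈-++⁺ʳ (variables φ))

  -- Truth is ¬¬-stable, so we may assume the finitely many variables of φ decided.
  taut-sound : ∀ {φ} → Taut φ → Γ , s , f ⊨ φ
  taut-sound {s} {f} {φ} φ-taut = ⊨-stable φ λ ¬p → ¬¬-decisions s f (variables φ) λ ds →
    ¬p (to (evalB-correct φ (valuation s f _ ds) (valuation-correct s f _ ds))
           (from T-≡ (φ-taut (valuation s f _ ds))))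

  ⊨-⋁ : ∀ {A : Set} (h : A → Form n m) ψ xs {x} → x ∈ xs →
        Γ , s , f ⊨ h x → Γ , s , f ⊨ bigOr ψ (map h xs)
  ⊨-⋁ h ψ (_ ∷ _) (here refl) p = λ (¬p , _) → ¬p p
  ⊨-⋁ h ψ (_ ∷ xs) (there x∈xs) p = λ (_ , ¬q) → ¬q (⊨-⋁ h ψ xs x∈xs p)

  ⊨-⋀ : ∀ {A : Set} (h : A → Form n m) ψ xs {x} → x ∈ xs →
        Γ , s , f ⊨ bigAnd ψ (map h xs) → Γ , s , f ⊨ h x
  ⊨-⋀ h ψ (_ ∷ _) (here refl) = proj₁
  ⊨-⋀ h ψ (_ ∷ xs) (there x∈xs) = ⊨-⋀ h ψ xs x∈xs ∘ proj₂

  ⊨-cn : ∀ ψ X → Γ , s , f ⊨ cn ψ X → proj₁ s ≡ X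
  ⊨-cn {s} {f} ψ X p = begin
    proj₁ s                         ≡⟨ tabulate∘lookup (proj₁ s) ⟨
    Vec.tabulate (lookup (proj₁ s)) ≡⟨ tabulate-cong pointwise ⟩
    Vec.tabulate (lookup X)         ≡⟨ tabulate∘lookup X ⟩
    X                               ∎
    where
      open ≡-Reasoning

      ⊨-lit : ∀ {i} b → Γ , s , f ⊨ (if b then atom i else ~ atom i) → lookup (proj₁ s) i ≡ b
      ⊨-lit {i} true p = to T-≡ p
      ⊨-lit {i} false ¬p with lookup (proj₁ s) i
      ... | true = ⊥-elim (¬p _)
      ... | false = refl

      pointwise : ∀ i → lookup (proj₁ s) i ≡ lookup X i
      pointwise i = ⊨-lit (lookup X i) (⊨-⋀ (lit X) ψ (allFin n) (∈-allFin i) p)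

  state-≡ : ∀ {s s′ : State Γ} → proj₁ s ≡ proj₁ s′ → s ≡ s′
  state-≡ {X , p} {.X , q} refl = cong (X ,_) (T-irrelevant p q)

  sound : ∀ {φ} → PLC φ → ∀ s f → Φ Γ f → Γ , s , f ⊨ φ
  sound (taut {φ} φ-taut) s f _ = taut-sound {s} {f} {φ} φ-taut
  sound (mp {φ} {ψ} p q) s f Φf = ⊨-mp φ ψ (sound q s f Φf) (sound p s f Φf)
  sound (axK I φ ψ) s f _ ((□φ , □φ⇒ψ) , ¬□ψ) = ¬□ψ λ s′ → ⊨-mp φ ψ (□φ⇒ψ s′) (□φ s′)
  sound (axK F φ ψ) s f _ ((□φ , □φ⇒ψ) , ¬□ψ) =
    ¬□ψ λ f′ Φf′ → ⊨-mp φ ψ (□φ⇒ψ f′ Φf′) (□φ f′ Φf′)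
  sound (axT I φ) s f _ (□φ , ¬φ) = ¬φ (□φ s)
  sound (axT F φ) s f Φf (□φ , ¬φ) = ¬φ (□φ f Φf)
  sound (ax4 I φ) s f _ (□φ , ¬□□φ) = ¬□□φ λ _ → □φ
  sound (ax4 F φ) s f _ (□φ , ¬□□φ) = ¬□□φ λ _ _ → □φ
  sound (ax5 I φ) s f _ (¬□φ , ¬□¬□φ) = ¬□¬□φ λ _ → ¬□φ
  sound (ax5 F φ) s f _ (¬□φ , ¬□¬□φ) = ¬□¬□φ λ _ _ → ¬□φ
  sound (comm φ) s f _ = (λ (□□φ , ¬□□φ) → ¬□□φ λ s′ f′ Φf′ → □□φ f′ Φf′ s′)
                       , (λ (□□φ , ¬□□φ) → ¬□□φ λ f′ Φf′ s′ → □□φ s′ f′ Φf′)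
  sound (atLeast ψ) s f _ = ⊨-⋁ t ψ (allFin m) (∈-allFin (f s)) refl
  sound (atMost x y x≢y) s f _ (fs≡x , ¬¬fs≡y) = ¬¬fs≡y λ fs≡y → x≢y (trans (sym fs≡x) fs≡y)
  sound (funct ψ X x) s f _ ((cn-s , fs≡x) , ¬□) = ¬□ λ s′ (cn-s′ , fs′≢x) →
    fs′≢x (trans (cong f (state-≡ (trans (⊨-cn ψ X cn-s′) (sym (⊨-cn ψ X cn-s))))) fs≡x)
  sound (indep+ p) s f _ (p∈s , ¬□p) = ¬□p λ _ _ → p∈s
  sound (indep- p) s f _ (p∉s , ¬□¬p) = ¬□¬p λ _ _ → p∉s
  sound (nec I p) s f Φf s′ = sound p s′ f Φf
  sound (nec F p) s f _ f′ Φf′ = sound p s f′ Φf′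

corollary1 : (n m : ℕ) (φ : Form n m) →
    (PLC φ → Valid φ) × (Valid φ → PLC φ)
corollary1 n m φ = (λ ⊢φ Γ s f Φf → Soundness.sound Γ ⊢φ s f Φf) , complete m φ
  where
    -- With no values AtLeast is ⋁ ∅ = ⊥ and proves everything; otherwise some value is needed
    -- as a default for the choice functions in the completeness proof.
    complete : ∀ m (φ : Form n m) → Valid φ → PLC φ
    complete zero φ _ = mp (atLeast φ) (Derivations.falsum-elim)
    complete (suc _) φ = Completeness.complete φ fzero φ
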